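{- Let $n,k$ be integers with $n\ge 2$ and $2\le k\le n-1$. Then \[ a_k^n\ge \max\bigl\{n-k(k-1)-1,\ \lceil (n-k)/k\rceil,\ 1\bigr\}. \]
   Context: A matrix is NZ if every row and column has a positive entry; the weight of a nonnegative vector is its number of positive entries; $A_{*i}$ is the $i$-th column of $A$ and $\mathrm{supp}(v)=\{i:v_i>0\}$. For $2\le k\le n-1$, $\mathcal{S}_n^k$ is the set of $n\times n$ nonnegative NZ matrices all of whose rows and columns have weight at most $k$ and having at least one column of weight exactly $k$; for $A\in\mathcal{S}_n^k$, $\mathcal{C}_A$ is the set of indices of columns of weight $k$, $a_k^n(A)=\min_{c\in\mathcal{C}_A}|\{i:\mathrm{supp}(A_{*i})\not\subseteq\mathrm{supp}(A_{*c})\}|$, and $a_k^n=\min_{A\in\mathcal{S}_n^k}a_k^n(A)$.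
   Formalization: The matrices in $\mathcal{S}_n^k$ have rational entries. -}

module Defs where

open import Data.Nat using (ℕ; zero; suc; _+_; _∸_; _≤_)
open import Data.Nat.DivMod using (_/_)
open import Data.Fin using (Fin)
open import Data.Fin.Properties using (any?)
open import Data.List using (List; length; filter)
import Agda.Primitive
open import Data.Fin.Base using ()
open import Data.List using (allFin)
open import Data.Rational using (ℚ; 0ℚ; _<_; _≤_)
open import Data.Rational.Properties using (_<?_)
open import Data.Product using (Σ; ∃; _×_)
open import Relation.Nullary using (¬_; Dec)
open import Relation.Nullary.Decidable using (¬?; _×-dec_)
open import Relation.Unary using (Pred; Decidable)

-- n × n matrices with rational entries, A i j = entry in row i, column j
Matrix : ℕ → Set
Matrix n = Fin n → Fin n → ℚ

countFin : ∀ {n} {P : Pred (Fin n) Agda.Primitive.lzero} → Decidable P → ℕ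
countFin {n} P? = length (filter P? (allFin n))

Nonneg : ∀ {n} → Matrix n → Set
Nonneg A = ∀ i j → 0ℚ Data.Rational.≤ A i j

rowWeight : ∀ {n} → Matrix n → Fin n → ℕ
rowWeight A i = countFin (λ j → 0ℚ <? A i j)

colWeight : ∀ {n} → Matrix n → Fin n → ℕ
colWeight A j = countFin (λ i → 0ℚ <? A i j)

NZ : ∀ {n} → Matrix n → Set
NZ A = (∀ i → ∃ λ j → 0ℚ < A i j) × (∀ j → ∃ λ i → 0ℚ < A i j)

InS : (n k : ℕ) → Matrix n → Set
InS n k A = Nonneg A × NZ A
          × (∀ i → rowWeight A i Data.Nat.≤ k)
          × (∀ j → colWeight A j Data.Nat.≤ k)
          × (∃ λ c → colWeight A c ≡ k)
  where open import Relation.Binary.PropositionalEquality using (_≡_)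

-- supp(A_{*i}) ⊄ supp(A_{*c}): some row r has A r i > 0 but not A r c > 0
NotSubCol : ∀ {n} → Matrix n → Fin n → Fin n → Set
NotSubCol A c i = ∃ λ r → (0ℚ < A r i) × ¬ (0ℚ < A r c)

NotSubCol? : ∀ {n} (A : Matrix n) (c : Fin n) → Decidable (NotSubCol A c)
NotSubCol? A c i = any? (λ r → (0ℚ <? A r i) ×-dec ¬? (0ℚ <? A r c))

nonSubCount : ∀ {n} → Matrix n → Fin n → ℕ
nonSubCount A c = countFin (NotSubCol? A c)

-- ceiling division ⌈ a / b ⌉ for b ≥ 1 (value at b = 0 is irrelevant)
ceilDiv : ℕ → ℕ → ℕ
ceilDiv a zero    = 0
ceilDiv a (suc b) = (a + b) / suc b

-- Let a be the number of columns whose support is not contained in supp(A_{*c}); the proof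
-- double counts positive entries of A. Each of the n − k rows outside supp(A_{*c}) has a positive
-- entry, necessarily in one of those a columns, and each column covers at most k rows, so
-- n − k ≤ k · a, whence a ≥ ⌈(n − k)/k⌉ ≥ 1. The remaining n − a columns have all their positive
-- entries among the k rows of supp(A_{*c}), which carry at most k² positive entries; A_{*c} uses
-- k of them and every other such column at least one, so n − a ≤ k(k − 1) + 1.
module Submission where

open import Defs
open import Data.Nat using (ℕ; _≤_; _∸_; _*_; _⊔_)
open import Data.Fin using (Fin)
open import Relation.Binary.PropositionalEquality using (_≡_)

open import Level using (0ℓ)
open import Data.Nat using (zero; suc; _+_; z≤n; s≤s; _<_; >-nonZero; >-nonZero⁻¹)
open import Data.Nat.Properties
open import Data.Nat.DivMod using (m<n*o⇒m/o<n)
open import Data.Fin as Fin using ()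
open import Data.List using (length; filter; tabulate)
open import Data.Product using (∃; _×_; _,_)
open import Data.Rational using (0ℚ) renaming (_<_ to _<ℚ_)
open import Data.Rational.Properties using () renaming (_<?_ to _<ℚ?_)
open import Relation.Nullary using (¬_; Dec; yes; no; contradiction)
open import Relation.Nullary.Decidable using (¬?; decidable-stable)
open import Relation.Unary using (Pred; Decidable)
open import Relation.Binary.PropositionalEquality using (refl; sym; cong; cong₂; module ≡-Reasoning)
open import Function using (_∘_; id)
open import Data.Nat.Tactic.RingSolver using (solve-∀)
open import Algebra.Properties.Semiring.Sum +-*-semiring
  using (sum-syntax; sum-cong-≗; ∑-distrib-+; ∑-comm; *-distribˡ-sum; *-distribʳ-sum)

𝟙 : ∀ {p} {P : Set p} → Dec P → ℕ
𝟙 (yes _) = 1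
𝟙 (no _)  = 0

𝟙-yes : ∀ {p} {P : Set p} (P? : Dec P) → P → 𝟙 P? ≡ 1
𝟙-yes (yes _) _ = refl
𝟙-yes (no ¬p) p = contradiction p ¬p

𝟙+𝟙¬≡1 : ∀ {p} {P : Set p} (P? : Dec P) → 𝟙 P? + 𝟙 (¬? P?) ≡ 1
𝟙+𝟙¬≡1 (yes _) = refl
𝟙+𝟙¬≡1 (no _)  = refl

∑-mono-≤ : ∀ {n} {f g : Fin n → ℕ} → (∀ i → f i ≤ g i) → ∑[ i < n ] f i ≤ ∑[ i < n ] g i
∑-mono-≤ {zero}  f≤g = z≤n
∑-mono-≤ {suc n} f≤g = +-mono-≤ (f≤g Fin.zero) (∑-mono-≤ (f≤g ∘ Fin.suc))

summand≤∑ : ∀ {n} (f : Fin n → ℕ) i → f i ≤ ∑[ j < n ] f j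
summand≤∑ f Fin.zero    = m≤m+n _ _
summand≤∑ f (Fin.suc i) = ≤-trans (summand≤∑ (f ∘ Fin.suc) i) (m≤n+m _ _)

length-filter-tabulate : ∀ {a m} {A : Set a} {P : Pred A 0ℓ} (P? : Decidable P) (f : Fin m → A) →
  length (filter P? (tabulate f)) ≡ ∑[ i < m ] 𝟙 (P? (f i))
length-filter-tabulate {m = zero}  P? f = refl
length-filter-tabulate {m = suc m} P? f with P? (f Fin.zero)
... | yes _ = cong suc (length-filter-tabulate P? (f ∘ Fin.suc))
... | no _  = length-filter-tabulate P? (f ∘ Fin.suc)

countFin≡∑𝟙 : ∀ {n} {P : Pred (Fin n) 0ℓ} (P? : Decidable P) → countFin P? ≡ ∑[ i < n ] 𝟙 (P? i)
countFin≡∑𝟙 P? = length-filter-tabulate P? id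

countFin-complement : ∀ {n} {P : Pred (Fin n) 0ℓ} (P? : Decidable P) →
  countFin P? + countFin (λ i → ¬? (P? i)) ≡ n
countFin-complement {n} P? = begin
  countFin P? + countFin (λ i → ¬? (P? i))      ≡⟨ cong₂ _+_ (countFin≡∑𝟙 P?) (countFin≡∑𝟙 (λ i → ¬? (P? i))) ⟩
  ∑[ i < n ] 𝟙 (P? i) + ∑[ i < n ] 𝟙 (¬? (P? i)) ≡⟨ ∑-distrib-+ (λ i → 𝟙 (P? i)) (λ i → 𝟙 (¬? (P? i))) ⟨
  ∑[ i < n ] (𝟙 (P? i) + 𝟙 (¬? (P? i)))          ≡⟨ sum-cong-≗ (λ i → 𝟙+𝟙¬≡1 (P? i)) ⟩
  ∑[ i < n ] 1                                   ≡⟨ ∑1≡n n ⟩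
  n                                              ∎
  where
  open ≡-Reasoning
  ∑1≡n : ∀ n → ∑[ i < n ] 1 ≡ n
  ∑1≡n zero    = refl
  ∑1≡n (suc n) = cong suc (∑1≡n n)

countFin-pos : ∀ {n} {P : Pred (Fin n) 0ℓ} (P? : Decidable P) {i} → P i → 1 ≤ countFin P?
countFin-pos {n} P? {i} p = begin
  1                    ≡⟨ 𝟙-yes (P? i) p ⟨
  𝟙 (P? i)             ≤⟨ summand≤∑ (λ j → 𝟙 (P? j)) i ⟩
  ∑[ j < n ] 𝟙 (P? j)  ≡⟨ countFin≡∑𝟙 P? ⟨
  countFin P?          ∎
  where open ≤-Reasoning

weightedCount : ∀ {n} {P : Pred (Fin n) 0ℓ} → Decidable P → (Fin n → ℕ) → ℕ
weightedCount {n} P? w = ∑[ i < n ] (𝟙 (P? i) * w i)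

weightedCount≤countFin* : ∀ {n} {P : Pred (Fin n) 0ℓ} (P? : Decidable P) {w : Fin n → ℕ} {k} →
  (∀ i → w i ≤ k) → weightedCount P? w ≤ countFin P? * k
weightedCount≤countFin* {n} P? {w} {k} w≤k = begin
  ∑[ i < n ] (𝟙 (P? i) * w i)    ≤⟨ ∑-mono-≤ (λ i → *-monoʳ-≤ (𝟙 (P? i)) (w≤k i)) ⟩
  ∑[ i < n ] (𝟙 (P? i) * k)     ≡⟨ *-distribʳ-sum k (λ i → 𝟙 (P? i)) ⟨
  (∑[ i < n ] 𝟙 (P? i)) * k    ≡⟨ cong (_* k) (countFin≡∑𝟙 P?) ⟨
  countFin P? * k              ∎
  where open ≤-Reasoning

countFin+∸1≤weightedCount : ∀ {n} {P : Pred (Fin n) 0ℓ} (P? : Decidable P) {w : Fin n → ℕ} →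
  (∀ i → 1 ≤ w i) → ∀ {c} → P c → countFin P? + (w c ∸ 1) ≤ weightedCount P? w
countFin+∸1≤weightedCount {n} P? {w} 1≤w {c} pc = begin
  countFin P? + (w c ∸ 1)                                 ≡⟨ cong₂ _+_ (countFin≡∑𝟙 P?) (sym (*-identityˡ _)) ⟩
  ∑[ i < n ] 𝟙 (P? i) + 1 * (w c ∸ 1)                     ≡⟨ cong (λ b → ∑[ i < n ] 𝟙 (P? i) + b * (w c ∸ 1)) (𝟙-yes (P? c) pc) ⟨
  ∑[ i < n ] 𝟙 (P? i) + 𝟙 (P? c) * (w c ∸ 1)              ≤⟨ +-monoʳ-≤ _ (summand≤∑ (λ i → 𝟙 (P? i) * (w i ∸ 1)) c) ⟩
  ∑[ i < n ] 𝟙 (P? i) + ∑[ i < n ] (𝟙 (P? i) * (w i ∸ 1)) ≡⟨ ∑-distrib-+ (λ i → 𝟙 (P? i)) (λ i → 𝟙 (P? i) * (w i ∸ 1)) ⟨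
  ∑[ i < n ] (𝟙 (P? i) + 𝟙 (P? i) * (w i ∸ 1))            ≡⟨ sum-cong-≗ (λ i → *-pred (𝟙 (P? i)) (1≤w i)) ⟨
  ∑[ i < n ] (𝟙 (P? i) * w i)                             ∎
  where
  open ≤-Reasoning
  *-pred : ∀ b {m} → 1 ≤ m → b * m ≡ b + b * (m ∸ 1)
  *-pred b {suc m} _ = *-suc b m

module Incidence {m n} {E : Fin m → Fin n → Set} (E? : ∀ r j → Dec (E r j)) where

  colDegree : Fin n → ℕ
  colDegree j = countFin (λ r → E? r j)

  rowDegree : Fin m → ℕ
  rowDegree r = countFin (E? r)

  weightedCount-colDegree : {P : Pred (Fin n) 0ℓ} (P? : Decidable P) →
    weightedCount P? colDegree ≡ ∑[ r < m ] ∑[ j < n ] (𝟙 (P? j) * 𝟙 (E? r j))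
  weightedCount-colDegree P? = begin
    ∑[ j < n ] (𝟙 (P? j) * colDegree j)              ≡⟨ sum-cong-≗ (λ j → cong (𝟙 (P? j) *_) (countFin≡∑𝟙 (λ r → E? r j))) ⟩
    ∑[ j < n ] (𝟙 (P? j) * ∑[ r < m ] 𝟙 (E? r j))    ≡⟨ sum-cong-≗ (λ j → *-distribˡ-sum (𝟙 (P? j)) (λ r → 𝟙 (E? r j))) ⟩
    ∑[ j < n ] ∑[ r < m ] (𝟙 (P? j) * 𝟙 (E? r j))    ≡⟨ ∑-comm (λ j r → 𝟙 (P? j) * 𝟙 (E? r j)) ⟩
    ∑[ r < m ] ∑[ j < n ] (𝟙 (P? j) * 𝟙 (E? r j))    ∎
    where open ≡-Reasoning

  covered-countFin≤ : {Q : Pred (Fin m) 0ℓ} (Q? : Decidable Q) {P : Pred (Fin n) 0ℓ} (P? : Decidable P) {k : ℕ} →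
    (∀ r → Q r → ∃ λ j → P j × E r j) → (∀ j → colDegree j ≤ k) → countFin Q? ≤ countFin P? * k
  covered-countFin≤ Q? P? {k} covered colDegree≤k = begin
    countFin Q?                                    ≡⟨ countFin≡∑𝟙 Q? ⟩
    ∑[ r < m ] 𝟙 (Q? r)                            ≤⟨ ∑-mono-≤ 𝟙Q≤incidences ⟩
    ∑[ r < m ] ∑[ j < n ] (𝟙 (P? j) * 𝟙 (E? r j))  ≡⟨ weightedCount-colDegree P? ⟨
    weightedCount P? colDegree                     ≤⟨ weightedCount≤countFin* P? colDegree≤k ⟩
    countFin P? * k                                ∎
    where
    open ≤-Reasoning
    𝟙Q≤incidences : ∀ r → 𝟙 (Q? r) ≤ ∑[ j < n ] (𝟙 (P? j) * 𝟙 (E? r j))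
    𝟙Q≤incidences r with Q? r
    ... | no _   = z≤n
    ... | yes qr with covered r qr
    ...   | j , pj , erj = begin
      1                                     ≡⟨ cong₂ _*_ (𝟙-yes (P? j) pj) (𝟙-yes (E? r j) erj) ⟨
      𝟙 (P? j) * 𝟙 (E? r j)                 ≤⟨ summand≤∑ (λ j → 𝟙 (P? j) * 𝟙 (E? r j)) j ⟩
      ∑[ j < n ] (𝟙 (P? j) * 𝟙 (E? r j))    ∎

  supported-weightedCount≤ : {P : Pred (Fin n) 0ℓ} (P? : Decidable P) {Q : Pred (Fin m) 0ℓ} (Q? : Decidable Q) {k : ℕ} →
    (∀ r j → P j → E r j → Q r) → (∀ r → rowDegree r ≤ k) → weightedCount P? colDegree ≤ countFin Q? * k
  supported-weightedCount≤ P? Q? {k} supported rowDegree≤k = begin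
    weightedCount P? colDegree                     ≡⟨ weightedCount-colDegree P? ⟩
    ∑[ r < m ] ∑[ j < n ] (𝟙 (P? j) * 𝟙 (E? r j))  ≤⟨ ∑-mono-≤ (λ r → ∑-mono-≤ (𝟙P*𝟙E≤𝟙Q*𝟙E r)) ⟩
    ∑[ r < m ] ∑[ j < n ] (𝟙 (Q? r) * 𝟙 (E? r j))  ≡⟨ sum-cong-≗ (λ r → *-distribˡ-sum (𝟙 (Q? r)) (λ j → 𝟙 (E? r j))) ⟨
    ∑[ r < m ] (𝟙 (Q? r) * ∑[ j < n ] 𝟙 (E? r j))  ≡⟨ sum-cong-≗ (λ r → cong (𝟙 (Q? r) *_) (countFin≡∑𝟙 (E? r))) ⟨
    weightedCount Q? rowDegree                     ≤⟨ weightedCount≤countFin* Q? rowDegree≤k ⟩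
    countFin Q? * k                                ∎
    where
    open ≤-Reasoning
    𝟙P*𝟙E≤𝟙Q*𝟙E : ∀ r j → 𝟙 (P? j) * 𝟙 (E? r j) ≤ 𝟙 (Q? r) * 𝟙 (E? r j)
    𝟙P*𝟙E≤𝟙Q*𝟙E r j with P? j | E? r j
    ... | no _   | _      = z≤n
    ... | yes _  | no _   = ≤-reflexive (sym (*-zeroʳ (𝟙 (Q? r))))
    ... | yes pj | yes erj = ≤-reflexive (cong (_* 1) (sym (𝟙-yes (Q? r) (supported r j pj erj))))

ceilDiv-least : ∀ a b q → a ≤ q * b → ceilDiv a b ≤ q
ceilDiv-least a zero    q _    = z≤n
ceilDiv-least a (suc b) q a≤qb = m<1+n⇒m≤n (m<n*o⇒m/o<n (begin-strict
  a + b          ≡⟨ +-comm a b ⟩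
  b + a          <⟨ n<1+n (b + a) ⟩
  suc b + a      ≤⟨ +-monoʳ-≤ (suc b) a≤qb ⟩
  suc q * suc b  ∎))
  where open ≤-Reasoning

m+[k∸1]≤k*k⇒m≤k*[k∸1]+1 : ∀ m k → m + (k ∸ 1) ≤ k * k → m ≤ k * (k ∸ 1) + 1
m+[k∸1]≤k*k⇒m≤k*[k∸1]+1 m zero     m≤0 = m≤n⇒m≤1+n (m+n≤o⇒m≤o m m≤0)
m+[k∸1]≤k*k⇒m≤k*[k∸1]+1 m (suc k′) h   =
  +-cancelʳ-≤ k′ m (suc k′ * k′ + 1) (≤-trans h (≤-reflexive (square-split k′)))
  where
  square-split : ∀ k′ → suc k′ * suc k′ ≡ (suc k′ * k′ + 1) + k′
  square-split = solve-∀

module _ {n} (A : Matrix n) (c : Fin n) where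

  positive? : ∀ r j → Dec (0ℚ <ℚ A r j)
  positive? r j = 0ℚ <ℚ? A r j

  -- colDegree and rowDegree are now colWeight A and rowWeight A, definitionally.
  open Incidence positive?

  SubCol? : Decidable (λ j → ¬ NotSubCol A c j)
  SubCol? j = ¬? (NotSubCol? A c j)

  ¬NotSubCol-self : ¬ NotSubCol A c c
  ¬NotSubCol-self (r , A[r,c]>0 , A[r,c]≯0) = A[r,c]≯0 A[r,c]>0

  ¬NotSubCol⇒supp⊆ : ∀ r j → ¬ NotSubCol A c j → 0ℚ <ℚ A r j → 0ℚ <ℚ A r c
  ¬NotSubCol⇒supp⊆ r j ¬notSub A[r,j]>0 =
    decidable-stable (positive? r c) (λ A[r,c]≯0 → ¬notSub (r , A[r,j]>0 , A[r,c]≯0))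

  rowOutsideSupp⇒NotSubCol : (∀ i → ∃ λ j → 0ℚ <ℚ A i j) →
    ∀ r → ¬ (0ℚ <ℚ A r c) → ∃ λ j → NotSubCol A c j × 0ℚ <ℚ A r j
  rowOutsideSupp⇒NotSubCol rowNZ r A[r,c]≯0 =
    let (j , A[r,j]>0) = rowNZ r in j , (r , A[r,j]>0 , A[r,c]≯0) , A[r,j]>0

  n∸k≤nonSubCount*k : ∀ {k} → InS n k A → colWeight A c ≡ k → n ∸ k ≤ nonSubCount A c * k
  n∸k≤nonSubCount*k {k} (_ , (rowNZ , _) , _ , colWeight≤k , _) colWeight≡k = m≤n+o⇒m∸n≤o n k (begin
    n                                                     ≡⟨ countFin-complement (λ r → positive? r c) ⟨
    colWeight A c + countFin (λ r → ¬? (positive? r c))   ≡⟨ cong (_+ _) colWeight≡k ⟩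
    k + countFin (λ r → ¬? (positive? r c))               ≤⟨ +-monoʳ-≤ k uncoveredRows≤ ⟩
    k + nonSubCount A c * k                               ∎)
    where
    open ≤-Reasoning
    uncoveredRows≤ : countFin (λ r → ¬? (positive? r c)) ≤ nonSubCount A c * k
    uncoveredRows≤ = covered-countFin≤ (λ r → ¬? (positive? r c)) (NotSubCol? A c)
                       (rowOutsideSupp⇒NotSubCol rowNZ) colWeight≤k

  subColCount≤k*[k∸1]+1 : ∀ {k} → InS n k A → colWeight A c ≡ k → countFin SubCol? ≤ k * (k ∸ 1) + 1
  subColCount≤k*[k∸1]+1 {k} (_ , (_ , colNZ) , rowWeight≤k , _ , _) colWeight≡k =
    m+[k∸1]≤k*k⇒m≤k*[k∸1]+1 (countFin SubCol?) k (begin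
      countFin SubCol? + (k ∸ 1)               ≡⟨ cong (λ w → countFin SubCol? + (w ∸ 1)) colWeight≡k ⟨
      countFin SubCol? + (colWeight A c ∸ 1)   ≤⟨ countFin+∸1≤weightedCount SubCol? colWeight≥1 ¬NotSubCol-self ⟩
      weightedCount SubCol? colDegree          ≤⟨ supported-weightedCount≤ SubCol? (λ r → positive? r c) ¬NotSubCol⇒supp⊆ rowWeight≤k ⟩
      colWeight A c * k                        ≡⟨ cong (_* k) colWeight≡k ⟩
      k * k                                    ∎)
    where
    open ≤-Reasoning
    colWeight≥1 : ∀ j → 1 ≤ colWeight A j
    colWeight≥1 j = let (r , A[r,j]>0) = colNZ j in countFin-pos (λ r → positive? r j) A[r,j]>0

lemma3p4 : (n k : ℕ) → 2 ≤ n → 2 ≤ k → k ≤ n ∸ 1 →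
    (A : Matrix n) → InS n k A →
    (c : Fin n) → colWeight A c ≡ k →
    ((n ∸ k * (k ∸ 1) ∸ 1) ⊔ ceilDiv (n ∸ k) k ⊔ 1) ≤ nonSubCount A c
lemma3p4 n@(suc _) k _ _ k≤n-1 A A∈S c colWeight≡k = ⊔-lub (⊔-lub bound₁ bound₂) bound₃
  where
  open ≤-Reasoning
  N s : ℕ
  N = nonSubCount A c
  s = countFin (SubCol? A c)

  n∸k≤N*k : n ∸ k ≤ N * k
  n∸k≤N*k = n∸k≤nonSubCount*k A c A∈S colWeight≡k

  bound₁ : n ∸ k * (k ∸ 1) ∸ 1 ≤ N
  bound₁ = begin
    n ∸ k * (k ∸ 1) ∸ 1    ≡⟨ ∸-+-assoc n (k * (k ∸ 1)) 1 ⟩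
    n ∸ (k * (k ∸ 1) + 1)  ≤⟨ ∸-monoʳ-≤ n (subColCount≤k*[k∸1]+1 A c A∈S colWeight≡k) ⟩
    n ∸ s                  ≡⟨ cong (_∸ s) (countFin-complement (NotSubCol? A c)) ⟨
    N + s ∸ s              ≡⟨ m+n∸n≡m N s ⟩
    N                      ∎

  bound₂ : ceilDiv (n ∸ k) k ≤ N
  bound₂ = ceilDiv-least (n ∸ k) k N n∸k≤N*k

  bound₃ : 1 ≤ N
  bound₃ = >-nonZero⁻¹ N {{m*n≢0⇒m≢0 N {{>-nonZero (≤-trans 0<n∸k n∸k≤N*k)}}}}
    where
    0<n∸k : 0 < n ∸ k
    0<n∸k = m<n⇒0<n∸m (s≤s k≤n-1)
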